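{- Let $\mathcal{H}$ be a pre-Hilbert category and $X$ an object. Then $\mathrm{ClSub}(X)$ is an orthomodular lattice: for all $m,n\in\mathrm{ClSub}(X)$ with $m\le n$, one has $m\vee(m^\perp\wedge n)=n$.
   Context: A $\dagger$-category is a category $\mathcal{H}$ with a functor $\dagger:\mathcal{H}^{\mathrm{op}}\to\mathcal{H}$ that is the identity on objects and satisfies $f^{\dagger\dagger}=f$. A morphism $m$ is a $\dagger$-mono if $m^\dagger m=\mathrm{id}$, a $\dagger$-epi if $mm^\dagger=\mathrm{id}$, and a $\dagger$-iso if both. A pre-Hilbert category is a $\dagger$-category such that: it has finite $\dagger$-biproducts (finite biproducts, including a zero object $0$, with projections $\pi$ and injections $\kappa$ satisfying $\pi^\dagger=\kappa$); it has finite $\dagger$-equalisers (equalisers that are $\dagger$-monos); every $\dagger$-mono is a kernel of some morphism; and it is symmetric $\dagger$-monoidal (symmetric monoidal with $(f\otimes g)^\dagger=f^\dagger\otimes g^\dagger$ and coherence isomorphisms $\dagger$-isos). Kernels $\ker(f)$ are chosen to be $\dagger$-monos. A subobject of $X$ is an equivalence class of monos into $X$ (modulo isomorphism of domains commuting with the monos), ordered by $M\le N$ iff $m=nf$ for some $f$; $\mathrm{ClSub}(X)$ is the poset of subobjects representable by a $\dagger$-mono. In $\mathrm{ClSub}(X)$ the meet $m\wedge n$ is given by the pullback of $m$ and $n$, and the join $m\vee n$ is the $\dagger$-mono part of the factorisation of $[m,n]:M\oplus N\to X$ as an epi followed by a $\dagger$-mono. For a $\dagger$-mono $m$, $m^\perp=\ker(m^\dagger)$.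 -}

module Defs where

open import Level using (Level; _⊔_) renaming (suc to lsuc)
open import Relation.Binary.PropositionalEquality using (_≡_)
open import Data.Product using (Σ; Σ-syntax; ∃; ∃-syntax; _×_; _,_)

record DaggerCategory (o ℓ : Level) : Set (lsuc (o ⊔ ℓ)) where
  infixr 9 _∘_
  infix 10 _†
  field
    Obj : Set o
    Hom : Obj → Obj → Set ℓ
    id  : ∀ {A} → Hom A A
    _∘_ : ∀ {A B C} → Hom B C → Hom A B → Hom A C
    identityˡ : ∀ {A B} {f : Hom A B} → id ∘ f ≡ f
    identityʳ : ∀ {A B} {f : Hom A B} → f ∘ id ≡ f
    assoc : ∀ {A B C D} {f : Hom A B} {g : Hom B C} {h : Hom C D} →
            (h ∘ g) ∘ f ≡ h ∘ (g ∘ f)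
    _† : ∀ {A B} → Hom A B → Hom B A
    †-id : ∀ {A} → (id {A}) † ≡ id
    †-∘ : ∀ {A B C} {f : Hom A B} {g : Hom B C} → (g ∘ f) † ≡ f † ∘ g †
    †-invol : ∀ {A B} {f : Hom A B} → (f †) † ≡ f

module DaggerNotions {o ℓ} (C : DaggerCategory o ℓ) where
  open DaggerCategory C

  IsMono : ∀ {A B} → Hom A B → Set (o ⊔ ℓ)
  IsMono {A} m = ∀ {Z} (f g : Hom Z A) → m ∘ f ≡ m ∘ g → f ≡ g

  IsEpi : ∀ {A B} → Hom A B → Set (o ⊔ ℓ)
  IsEpi {B = B} e = ∀ {Z} (f g : Hom B Z) → f ∘ e ≡ g ∘ e → f ≡ g

  IsIso : ∀ {A B} → Hom A B → Set ℓ
  IsIso {A} {B} f = Σ (Hom B A) λ g → (g ∘ f ≡ id) × (f ∘ g ≡ id)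

  IsDaggerMono : ∀ {A B} → Hom A B → Set ℓ
  IsDaggerMono m = m † ∘ m ≡ id

  IsDaggerEpi : ∀ {A B} → Hom A B → Set ℓ
  IsDaggerEpi m = m ∘ m † ≡ id

  IsDaggerIso : ∀ {A B} → Hom A B → Set ℓ
  IsDaggerIso m = IsDaggerMono m × IsDaggerEpi m

  ∃! : ∀ {A B} → (Hom A B → Set ℓ) → Set ℓ
  ∃! P = Σ _ λ u → P u × (∀ v → P v → v ≡ u)

  IsEqualiser : ∀ {A B E} → Hom A B → Hom A B → Hom E A → Set (o ⊔ ℓ)
  IsEqualiser {A} {B} {E} f g e =
    (f ∘ e ≡ g ∘ e) ×
    (∀ {Z} (h : Hom Z A) → f ∘ h ≡ g ∘ h → ∃! λ (u : Hom Z E) → e ∘ u ≡ h)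

  IsPullback : ∀ {A B X P} → Hom A X → Hom B X → Hom P A → Hom P B → Set (o ⊔ ℓ)
  IsPullback {A} {B} {X} {P} f g p₁ p₂ =
    (f ∘ p₁ ≡ g ∘ p₂) ×
    (∀ {Z} (h₁ : Hom Z A) (h₂ : Hom Z B) → f ∘ h₁ ≡ g ∘ h₂ →
       ∃! λ (u : Hom Z P) → (p₁ ∘ u ≡ h₁) × (p₂ ∘ u ≡ h₂))

  record ZeroObject : Set (o ⊔ ℓ) where
    field
      𝟘 : Obj
      ¡ : ∀ {A} → Hom 𝟘 A
      ¡-unique : ∀ {A} (f : Hom 𝟘 A) → f ≡ ¡
      ! : ∀ {A} → Hom A 𝟘
      !-unique : ∀ {A} (f : Hom A 𝟘) → f ≡ !

    0m : ∀ {A B} → Hom A B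
    0m = ¡ ∘ !

  module WithZero (Z : ZeroObject) where
    open ZeroObject Z public

    IsKernel : ∀ {A B K} → Hom A B → Hom K A → Set (o ⊔ ℓ)
    IsKernel f k = IsEqualiser f 0m k

    record DaggerBiproduct (A B : Obj) : Set (o ⊔ ℓ) where
      field
        A⊕B : Obj
        π₁ : Hom A⊕B A
        π₂ : Hom A⊕B B
        κ₁ : Hom A A⊕B
        κ₂ : Hom B A⊕B
        π₁κ₁ : π₁ ∘ κ₁ ≡ id
        π₂κ₂ : π₂ ∘ κ₂ ≡ id
        π₁κ₂ : π₁ ∘ κ₂ ≡ 0m
        π₂κ₁ : π₂ ∘ κ₁ ≡ 0m
        ⟨_,_⟩ : ∀ {Y} → Hom Y A → Hom Y B → Hom Y A⊕B
        π₁⟨⟩ : ∀ {Y} {f : Hom Y A} {g : Hom Y B} → π₁ ∘ ⟨ f , g ⟩ ≡ f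
        π₂⟨⟩ : ∀ {Y} {f : Hom Y A} {g : Hom Y B} → π₂ ∘ ⟨ f , g ⟩ ≡ g
        ⟨⟩-unique : ∀ {Y} {f : Hom Y A} {g : Hom Y B} (h : Hom Y A⊕B) →
                    π₁ ∘ h ≡ f → π₂ ∘ h ≡ g → h ≡ ⟨ f , g ⟩
        [_,_] : ∀ {Y} → Hom A Y → Hom B Y → Hom A⊕B Y
        []κ₁ : ∀ {Y} {f : Hom A Y} {g : Hom B Y} → [ f , g ] ∘ κ₁ ≡ f
        []κ₂ : ∀ {Y} {f : Hom A Y} {g : Hom B Y} → [ f , g ] ∘ κ₂ ≡ g
        []-unique : ∀ {Y} {f : Hom A Y} {g : Hom B Y} (h : Hom A⊕B Y) →
                    h ∘ κ₁ ≡ f → h ∘ κ₂ ≡ g → h ≡ [ f , g ]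
        π₁† : π₁ † ≡ κ₁
        π₂† : π₂ † ≡ κ₂

  record SymmetricDaggerMonoidal : Set (o ⊔ ℓ) where
    infixr 10 _⊗₀_ _⊗₁_
    field
      _⊗₀_ : Obj → Obj → Obj
      _⊗₁_ : ∀ {A B C D} → Hom A B → Hom C D → Hom (A ⊗₀ C) (B ⊗₀ D)
      ⊗-id : ∀ {A B} → (id {A}) ⊗₁ (id {B}) ≡ id
      ⊗-∘ : ∀ {A B C D E F} {f : Hom A B} {g : Hom B C} {h : Hom D E} {k : Hom E F} →
            (g ∘ f) ⊗₁ (k ∘ h) ≡ (g ⊗₁ k) ∘ (f ⊗₁ h)
      I : Obj
      α : ∀ {A B C} → Hom ((A ⊗₀ B) ⊗₀ C) (A ⊗₀ (B ⊗₀ C))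
      λ⇒ : ∀ {A} → Hom (I ⊗₀ A) A
      ρ⇒ : ∀ {A} → Hom (A ⊗₀ I) A
      σ : ∀ {A B} → Hom (A ⊗₀ B) (B ⊗₀ A)
      α-natural : ∀ {A A' B B' C C'} {f : Hom A A'} {g : Hom B B'} {h : Hom C C'} →
                  α ∘ ((f ⊗₁ g) ⊗₁ h) ≡ (f ⊗₁ (g ⊗₁ h)) ∘ α
      λ-natural : ∀ {A B} {f : Hom A B} → λ⇒ ∘ (id ⊗₁ f) ≡ f ∘ λ⇒
      ρ-natural : ∀ {A B} {f : Hom A B} → ρ⇒ ∘ (f ⊗₁ id) ≡ f ∘ ρ⇒
      σ-natural : ∀ {A A' B B'} {f : Hom A A'} {g : Hom B B'} →
                  σ ∘ (f ⊗₁ g) ≡ (g ⊗₁ f) ∘ σ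
      pentagon : ∀ {A B C D} →
                 (id {A} ⊗₁ α {B} {C} {D}) ∘ α ∘ (α ⊗₁ id) ≡ α ∘ α
      triangle : ∀ {A B} → (id {A} ⊗₁ λ⇒ {B}) ∘ α ≡ ρ⇒ ⊗₁ id
      hexagon : ∀ {A B C} →
                α {B} {C} {A} ∘ σ {A} ∘ α ≡ (id ⊗₁ σ) ∘ α ∘ (σ ⊗₁ id {C})
      σ-involutive : ∀ {A B} → σ {B} {A} ∘ σ {A} {B} ≡ id
      ⊗-† : ∀ {A B C D} {f : Hom A B} {g : Hom C D} → (f ⊗₁ g) † ≡ (f †) ⊗₁ (g †)
      α-†iso : ∀ {A B C} → IsDaggerIso (α {A} {B} {C})
      λ-†iso : ∀ {A} → IsDaggerIso (λ⇒ {A})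
      ρ-†iso : ∀ {A} → IsDaggerIso (ρ⇒ {A})
      σ-†iso : ∀ {A B} → IsDaggerIso (σ {A} {B})

record PreHilbert (o ℓ : Level) : Set (lsuc (o ⊔ ℓ)) where
  field
    cat : DaggerCategory o ℓ
  open DaggerCategory cat public
  open DaggerNotions cat public
  field
    zeroObj : ZeroObject
  open WithZero zeroObj public
  field
    -- finite dagger biproducts (zero object + binary dagger biproducts)
    biproduct : (A B : Obj) → DaggerBiproduct A B
    equaliser : ∀ {A B} (f g : Hom A B) →
                Σ Obj λ E → Σ (Hom E A) λ e → IsEqualiser f g e × IsDaggerMono e
    †mono-kernel : ∀ {K A} (m : Hom K A) → IsDaggerMono m →
                   Σ Obj λ B → Σ (Hom A B) λ f → IsKernel f m
    monoidal : SymmetricDaggerMonoidal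

  module Bip (A B : Obj) = DaggerBiproduct (biproduct A B)

  _⊕_ : Obj → Obj → Obj
  A ⊕ B = Bip.A⊕B A B

  copair : ∀ {A B Y} → Hom A Y → Hom B Y → Hom (A ⊕ B) Y
  copair {A} {B} f g = Bip.[_,_] A B f g

  _≤ₛ_ : ∀ {X M N} → Hom M X → Hom N X → Set ℓ
  _≤ₛ_ {M = M} {N} m n = Σ (Hom M N) λ f → m ≡ n ∘ f

  SameSub : ∀ {X M N} → Hom M X → Hom N X → Set ℓ
  SameSub {M = M} {N} m n = Σ (Hom M N) λ φ → IsIso φ × (m ≡ n ∘ φ)

module Submission where

-- The join j of m and m⊥ ∧ n lies below n because both components do and n ∘ n † fixes
-- everything factoring through n. For the converse, present j as the kernel of some g;
-- it suffices that g ∘ n = 0. With h = n † ∘ g †, the map n ∘ h is orthogonal to m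
-- (as m ≤ n), so it factors through m⊥ and hence through m⊥ ∧ n, on which g vanishes.
-- This gives h † ∘ h = g ∘ n ∘ h = 0, and positivity of the dagger forces h = 0.

open import Defs
open import Level using (Level)
open import Relation.Binary.PropositionalEquality using (_≡_; sym; trans; cong; cong₂; module ≡-Reasoning)
open import Data.Product using (Σ; _,_; proj₁)

module ZeroMorphisms {o ℓ} (C : DaggerCategory o ℓ) (Z : DaggerNotions.ZeroObject C) where
  open DaggerCategory C
  open DaggerNotions.ZeroObject Z

  0m-∘ : ∀ {A B D} {f : Hom A B} → 0m {B} {D} ∘ f ≡ 0m
  0m-∘ {f = f} = trans assoc (cong (¡ ∘_) (!-unique (! ∘ f)))

  ∘-0m : ∀ {A B D} {f : Hom B D} → f ∘ 0m {A} {B} ≡ 0m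
  ∘-0m {f = f} = trans (sym assoc) (cong (_∘ !) (¡-unique (f ∘ ¡)))

  0m-† : ∀ {A B} → (0m {A} {B}) † ≡ 0m
  0m-† = trans †-∘ (cong₂ _∘_ (¡-unique _) (!-unique _))

  †-reflects-0m : ∀ {A B} {f : Hom A B} → f † ≡ 0m → f ≡ 0m
  †-reflects-0m f†≡0 = trans (sym †-invol) (trans (cong _† f†≡0) 0m-†)

module DaggerMonos {o ℓ} (C : DaggerCategory o ℓ) where
  open DaggerCategory C
  open DaggerNotions C
  open ≡-Reasoning

  †-mono-cancelˡ : ∀ {A B D} {n : Hom A B} → IsDaggerMono n → (x : Hom D A) → n † ∘ (n ∘ x) ≡ x
  †-mono-cancelˡ {n = n} n†n≡id x = begin
    n † ∘ (n ∘ x) ≡⟨ sym assoc ⟩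
    (n † ∘ n) ∘ x ≡⟨ cong (_∘ x) n†n≡id ⟩
    id ∘ x        ≡⟨ identityˡ ⟩
    x             ∎

  †-mono⇒mono : ∀ {A B} {m : Hom A B} → IsDaggerMono m → IsMono m
  †-mono⇒mono {m = m} m†m≡id f g mf≡mg = begin
    f             ≡⟨ sym (†-mono-cancelˡ m†m≡id f) ⟩
    m † ∘ (m ∘ f) ≡⟨ cong (m † ∘_) mf≡mg ⟩
    m † ∘ (m ∘ g) ≡⟨ †-mono-cancelˡ m†m≡id g ⟩
    g             ∎

module Properties {o ℓ : Level} (H : PreHilbert o ℓ) where
  open PreHilbert H
  open ZeroMorphisms cat zeroObj
  open DaggerMonos cat
  open ≡-Reasoning

  ≤ₛ-antisym : ∀ {X M N} {m : Hom M X} {n : Hom N X} →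
               IsMono m → IsMono n → m ≤ₛ n → n ≤ₛ m → SameSub m n
  ≤ₛ-antisym {m = m} {n} m-mono n-mono (a , m≡na) (b , n≡mb) =
    a , (b , ba≡id , ab≡id) , m≡na
    where
    ba≡id : b ∘ a ≡ id
    ba≡id = m-mono (b ∘ a) id (begin
      m ∘ (b ∘ a) ≡⟨ sym assoc ⟩
      (m ∘ b) ∘ a ≡⟨ cong (_∘ a) (sym n≡mb) ⟩
      n ∘ a       ≡⟨ sym m≡na ⟩
      m           ≡⟨ sym identityʳ ⟩
      m ∘ id      ∎)
    ab≡id : a ∘ b ≡ id
    ab≡id = n-mono (a ∘ b) id (begin
      n ∘ (a ∘ b) ≡⟨ sym assoc ⟩
      (n ∘ a) ∘ b ≡⟨ cong (_∘ b) (sym m≡na) ⟩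
      m ∘ b       ≡⟨ sym n≡mb ⟩
      n           ≡⟨ sym identityʳ ⟩
      n ∘ id      ∎)

  kernel-annihilates : ∀ {A B K D} {f : Hom A B} {k : Hom K A} →
                       IsKernel f k → (x : Hom D K) → f ∘ (k ∘ x) ≡ 0m
  kernel-annihilates {f = f} {k} (fk≡0 , _) x = begin
    f ∘ (k ∘ x)  ≡⟨ sym assoc ⟩
    (f ∘ k) ∘ x  ≡⟨ cong (_∘ x) fk≡0 ⟩
    (0m ∘ k) ∘ x ≡⟨ cong (_∘ x) 0m-∘ ⟩
    0m ∘ x       ≡⟨ 0m-∘ ⟩
    0m           ∎

  kernel-factor : ∀ {A B K D} {f : Hom A B} {k : Hom K A} {x : Hom D A} →
                  IsKernel f k → f ∘ x ≡ 0m → x ≤ₛ k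
  kernel-factor {x = x} (_ , universal) fx≡0
    with universal x (trans fx≡0 (sym 0m-∘))
  ... | u , ku≡x , _ = u , sym ku≡x

  †-positive : ∀ {A B} (h : Hom A B) → h † ∘ h ≡ 0m → h ≡ 0m
  †-positive h h†h≡0 with equaliser (h †) 0m
  ... | _ , k , equalises@(h†k≡0k , _) , k†k≡id
    with kernel-factor equalises h†h≡0
  ... | c , h≡kc = begin
      h      ≡⟨ h≡kc ⟩
      k ∘ c  ≡⟨ cong (k ∘_) (†-reflects-0m c†≡0) ⟩
      k ∘ 0m ≡⟨ ∘-0m ⟩
      0m     ∎
    where
    c†≡0 : c † ≡ 0m
    c†≡0 = begin
      c †             ≡⟨ sym identityʳ ⟩
      c † ∘ id        ≡⟨ cong (c † ∘_) (sym k†k≡id) ⟩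
      c † ∘ (k † ∘ k) ≡⟨ sym assoc ⟩
      (c † ∘ k †) ∘ k ≡⟨ cong (_∘ k) (sym †-∘) ⟩
      (k ∘ c) † ∘ k   ≡⟨ cong (λ z → z † ∘ k) (sym h≡kc) ⟩
      h † ∘ k         ≡⟨ h†k≡0k ⟩
      0m ∘ k          ≡⟨ 0m-∘ ⟩
      0m              ∎

  ∘-copair : ∀ {A B X Y} (n : Hom Y X) (f : Hom A Y) (g : Hom B Y) →
             n ∘ copair f g ≡ copair (n ∘ f) (n ∘ g)
  ∘-copair {A} {B} n f g = []-unique (n ∘ copair f g)
    (trans assoc (cong (n ∘_) []κ₁))
    (trans assoc (cong (n ∘_) []κ₂))
    where open Bip A B

  epi-image-≤ₛ-†-mono : ∀ {A J N X} {j : Hom J X} {e : Hom A J} {n : Hom N X} {d : Hom A N} →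
                        IsDaggerMono n → IsEpi e → j ∘ e ≡ n ∘ d → j ≤ₛ n
  epi-image-≤ₛ-†-mono {j = j} {e} {n} {d} n†n≡id e-epi je≡nd =
    n † ∘ j , e-epi j (n ∘ (n † ∘ j)) (begin
      j ∘ e                 ≡⟨ je≡nd ⟩
      n ∘ d                 ≡⟨ cong (n ∘_) (sym (†-mono-cancelˡ n†n≡id d)) ⟩
      n ∘ (n † ∘ (n ∘ d))   ≡⟨ cong (λ z → n ∘ (n † ∘ z)) (sym je≡nd) ⟩
      n ∘ (n † ∘ (j ∘ e))   ≡⟨ cong (n ∘_) (sym assoc) ⟩
      n ∘ ((n † ∘ j) ∘ e)   ≡⟨ sym assoc ⟩
      (n ∘ (n † ∘ j)) ∘ e   ∎)

  †-∘-projection-≤ₛ : ∀ {X M N D} {m : Hom M X} {n : Hom N X} →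
                      IsDaggerMono n → m ≤ₛ n → (x : Hom D X) → m † ∘ (n ∘ (n † ∘ x)) ≡ m † ∘ x
  †-∘-projection-≤ₛ {m = m} {n} n†n≡id (f , m≡nf) x = begin
    m † ∘ (n ∘ (n † ∘ x))         ≡⟨ cong (_∘ (n ∘ (n † ∘ x))) m†≡f†n† ⟩
    (f † ∘ n †) ∘ (n ∘ (n † ∘ x)) ≡⟨ assoc ⟩
    f † ∘ (n † ∘ (n ∘ (n † ∘ x))) ≡⟨ cong (f † ∘_) (†-mono-cancelˡ n†n≡id (n † ∘ x)) ⟩
    f † ∘ (n † ∘ x)               ≡⟨ sym assoc ⟩
    (f † ∘ n †) ∘ x               ≡⟨ cong (_∘ x) (sym m†≡f†n†) ⟩
    m † ∘ x                       ∎
    where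
    m†≡f†n† : m † ≡ f † ∘ n †
    m†≡f†n† = trans (cong _† m≡nf) †-∘

  annihilates-≤ₛ-and-⊥-meet⇒annihilates :
    ∀ {X M N M⊥ P Y} {m : Hom M X} {n : Hom N X} {m⊥ : Hom M⊥ X}
      {p₁ : Hom P M⊥} {p₂ : Hom P N} {g : Hom X Y} →
    IsDaggerMono n → m ≤ₛ n → IsKernel (m †) m⊥ → IsPullback m⊥ n p₁ p₂ →
    g ∘ m ≡ 0m → g ∘ (m⊥ ∘ p₁) ≡ 0m → g ∘ n ≡ 0m
  annihilates-≤ₛ-and-⊥-meet⇒annihilates {m = m} {n} {m⊥} {p₁} {g = g}
    n†n≡id m≤n m⊥-kernel (_ , pullback) gm≡0 gm⊥p₁≡0 = begin
      g ∘ n   ≡⟨ sym h†≡gn ⟩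
      h †     ≡⟨ cong _† (†-positive h h†h≡0) ⟩
      0m †    ≡⟨ 0m-† ⟩
      0m      ∎
    where
    h = n † ∘ g †

    h†≡gn : h † ≡ g ∘ n
    h†≡gn = trans †-∘ (cong₂ _∘_ †-invol †-invol)

    nh⊥m : m † ∘ (n ∘ h) ≡ 0m
    nh⊥m = begin
      m † ∘ (n ∘ (n † ∘ g †)) ≡⟨ †-∘-projection-≤ₛ n†n≡id m≤n (g †) ⟩
      m † ∘ g †               ≡⟨ sym †-∘ ⟩
      (g ∘ m) †               ≡⟨ cong _† gm≡0 ⟩
      0m †                    ≡⟨ 0m-† ⟩
      0m                      ∎

    nh≤m⊥ : (n ∘ h) ≤ₛ m⊥
    nh≤m⊥ = kernel-factor m⊥-kernel nh⊥m
    open Σ nh≤m⊥ renaming (proj₁ to a; proj₂ to nh≡m⊥a)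
    open Σ (pullback a h (sym nh≡m⊥a)) renaming (proj₁ to w; proj₂ to w-factors)

    nh≡m⊥p₁w : n ∘ h ≡ (m⊥ ∘ p₁) ∘ w
    nh≡m⊥p₁w = begin
      n ∘ h         ≡⟨ nh≡m⊥a ⟩
      m⊥ ∘ a        ≡⟨ cong (m⊥ ∘_) (sym (proj₁ (proj₁ w-factors))) ⟩
      m⊥ ∘ (p₁ ∘ w) ≡⟨ sym assoc ⟩
      (m⊥ ∘ p₁) ∘ w ∎

    h†h≡0 : h † ∘ h ≡ 0m
    h†h≡0 = begin
      h † ∘ h             ≡⟨ cong (_∘ h) h†≡gn ⟩
      (g ∘ n) ∘ h         ≡⟨ assoc ⟩
      g ∘ (n ∘ h)         ≡⟨ cong (g ∘_) nh≡m⊥p₁w ⟩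
      g ∘ ((m⊥ ∘ p₁) ∘ w) ≡⟨ sym assoc ⟩
      (g ∘ (m⊥ ∘ p₁)) ∘ w ≡⟨ cong (_∘ w) gm⊥p₁≡0 ⟩
      0m ∘ w              ≡⟨ 0m-∘ ⟩
      0m                  ∎

theorem3 : ∀ {o ℓ : Level} (H : PreHilbert o ℓ) → let open PreHilbert H in
    ∀ {X M N : Obj} (m : Hom M X) (n : Hom N X) →
    IsDaggerMono m → IsDaggerMono n → m ≤ₛ n →
    ∀ {M⊥ : Obj} (m⊥ : Hom M⊥ X) → IsDaggerMono m⊥ → IsKernel (m †) m⊥ →
    ∀ {P : Obj} (p₁ : Hom P M⊥) (p₂ : Hom P N) → IsPullback m⊥ n p₁ p₂ →
    ∀ {J : Obj} (j : Hom J X) (e : Hom (M ⊕ P) J) → IsEpi e → IsDaggerMono j →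
    copair m (m⊥ ∘ p₁) ≡ j ∘ e →
    SameSub j n
theorem3 H {X} {M} m n _ n†n≡id m≤n@(f , m≡nf) m⊥ _ m⊥-kernel {P} p₁ p₂ pb@(m⊥p₁≡np₂ , _)
         j e e-epi j†j≡id join≡je =
  ≤ₛ-antisym (†-mono⇒mono j†j≡id) (†-mono⇒mono n†n≡id) j≤n n≤j
  where
  open PreHilbert H
  open Properties H
  open DaggerMonos cat
  open Bip M P using ([]κ₁; []κ₂)

  j≤n : j ≤ₛ n
  j≤n = epi-image-≤ₛ-†-mono n†n≡id e-epi (begin
    j ∘ e                       ≡⟨ sym join≡je ⟩
    copair m (m⊥ ∘ p₁)          ≡⟨ cong₂ copair m≡nf m⊥p₁≡np₂ ⟩
    copair (n ∘ f) (n ∘ p₂)     ≡⟨ sym (∘-copair n f p₂) ⟩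
    n ∘ copair f p₂             ∎)
    where open ≡-Reasoning

  n≤j : n ≤ₛ j
  n≤j with †mono-kernel j j†j≡id
  ... | _ , g , j-kernel = kernel-factor j-kernel
    (annihilates-≤ₛ-and-⊥-meet⇒annihilates n†n≡id m≤n m⊥-kernel pb
      (annihilates-join []κ₁) (annihilates-join []κ₂))
    where
    annihilates-join : ∀ {Z} {x : Hom Z (M ⊕ P)} {y : Hom Z X} →
                       copair m (m⊥ ∘ p₁) ∘ x ≡ y → g ∘ y ≡ 0m
    annihilates-join {x = x} {y} join∘x≡y = trans (cong (g ∘_) y≡j∘ex) (kernel-annihilates j-kernel (e ∘ x))
      where
      y≡j∘ex : y ≡ j ∘ (e ∘ x)
      y≡j∘ex = trans (sym join∘x≡y) (trans (cong (_∘ x) join≡je) assoc)
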